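{- Let $z$ be a vexillary involution in $S_\infty$, and let $p=q=0$ if $z=1$, otherwise $p=|\{i>0:i<z(i)\}|$ and $q=\max\{i>0:z(i)\ne i\}$. Then the vexillary weak order graph contains a directed path $z\xrightarrow{i_1}\cdots\xrightarrow{i_k}\mathsf{dom}_{pq}$ with $\{i_1,\dots,i_k\}\subseteq[q-1]$. Moreover, if $i<z(i)$ for all $i\in[p]$, then any such path has $p\notin\{i_1,\dots,i_k\}$.
   Context: $S_\infty$: permutations of $\mathbb{Z}$ fixing all $i\le0$ and all but finitely many $i$; $s_i=(i,i+1)$; $\ell$ = number of inversions; vexillary = $2143$-avoiding. The vexillary weak order graph has vertex set the vexillary involutions in $S_\infty$ and a labeled edge $v\xrightarrow{i}w$ whenever $w=s_ivs_i$ and $\ell(v)<\ell(w)$. For $q\ge2p$, $\mathsf{dom}_{pq}=(1,q)(2,q-1)\cdots(p,q-p+1)$ and $\mathsf{dom}_{00}=1$. -}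

module Defs where

open import Data.Nat using (ℕ; zero; suc; _+_; _∸_; _≤_; _<_; _≟_; _<?_; _≤?_; _⊔_)
open import Data.Nat.Properties using ()
open import Data.List using (List; []; _∷_; map; upTo; filter; length; foldr)
open import Data.Nat.ListAction using (sum)
open import Data.Product using (Σ; _×_; _,_)
open import Data.Bool using (if_then_else_)
open import Relation.Nullary using (¬_; yes; no; does)
open import Relation.Nullary.Decidable using (_×-dec_)
open import Relation.Binary.PropositionalEquality using (_≡_)

-- Elements of S_∞ are modelled as functions on ℕ, where the positive
-- integers 1,2,3,… are the points that may move; every integer ≤ 0 is
-- fixed by definition of S_∞, and is represented by the single point 0,
-- which is required to be fixed.  `bound` is an explicit bound beyond
-- which the permutation is the identity.  Injectivity together with
-- finite support makes `fun` a bijection.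
record Perm : Set where
  field
    fun       : ℕ → ℕ
    bound     : ℕ
    fix-zero  : fun 0 ≡ 0
    fix-above : ∀ i → bound < i → fun i ≡ i
    injective : ∀ i j → fun i ≡ fun j → i ≡ j
open Perm public

[1‥_] : ℕ → List ℕ
[1‥ n ] = map suc (upTo n)

invs : ℕ → (ℕ → ℕ) → ℕ
invs n f = sum (map (λ j → length (filter (λ i → (i <? j) ×-dec (f j <? f i)) [1‥ n ])) [1‥ n ])

-- Coxeter length ℓ = number of inversions (independent of the bound
-- chosen, as long as it bounds the support)
ℓ : Perm → ℕ
ℓ π = invs (bound π) (fun π)

IsInvolution : Perm → Set
IsInvolution π = ∀ i → fun π (fun π i) ≡ i

-- vexillary = 2143-avoiding: no a<b<c<d with π(b) < π(a) < π(d) < π(c)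
IsVexillary : Perm → Set
IsVexillary π = ∀ a b c d → 1 ≤ a → a < b → b < c → c < d →
  ¬ (fun π b < fun π a × fun π a < fun π d × fun π d < fun π c)

VexInv : Perm → Set
VexInv π = IsVexillary π × IsInvolution π

s : ℕ → ℕ → ℕ
s i j with j ≟ i
... | yes _ = suc i
... | no _ with j ≟ suc i
...   | yes _ = i
...   | no _  = j

Edge : Perm → ℕ → Perm → Set
Edge v i w = VexInv v × VexInv w × 1 ≤ i ×
             (∀ j → fun w j ≡ s i (fun v (s i j))) × ℓ v < ℓ w

data Path : Perm → (ℕ → ℕ) → List ℕ → Set where
  done : ∀ {v t} → (∀ j → fun v j ≡ t j) → Path v t []
  step : ∀ {v u t i is} → Edge v i u → Path u t is → Path v t (i ∷ is)

-- dom_{pq} = (1,q)(2,q-1)…(p,q-p+1)  (for q ≥ 2p; dom_{00} = 1)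
dom : ℕ → ℕ → ℕ → ℕ
dom p q j with 1 ≤? j | j ≤? p | (suc q ∸ p) ≤? j | j ≤? q
... | yes _ | yes _ | _     | _     = suc q ∸ j
... | yes _ | no _  | yes _ | yes _ = suc q ∸ j
... | _     | _     | _     | _     = j

pOf : Perm → ℕ
pOf z = length (filter (λ i → i <? fun z i) [1‥ bound z ])

qOf : Perm → ℕ
qOf z = foldr (λ i m → if does (fun z i ≟ i) then m else (i ⊔ m)) 0 [1‥ bound z ]

-- Conjugate z by s_i at a good ascent i < q, one with no pattern a < b < i where
-- z b < z a < z i and no pattern i + 1 < c < d where z (i + 1) < z d < z c. This keeps z a
-- vexillary involution, increases ℓ and leaves p and q unchanged; and whenever z has a
-- nontrivial ascent below q it has a good one, found by moving to crossing points of such patterns.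
-- Without nontrivial ascents, z descends on 1‥q apart from fixed blocks, which forces
-- z j = q + 1 − j on every moved j and makes the openers j < z j exactly 1‥p: z = dom p q.
-- For the second statement, "the openers are exactly 1‥p" survives every edge labelled i ≠ p and
-- makes p a descent, while every edge label is an ascent.

module Submission where

open import Defs
open import Data.Nat using (ℕ; zero; suc; _+_; _∸_; _*_; _⊔_; _≤_; _<_; _≟_; _<?_; _≤?_; _≡ᵇ_; z≤n; s≤s)
open import Data.Nat.Properties
open import Data.Nat.ListAction using (sum)
open import Data.Nat.ListAction.Properties using (sum-++)
open import Data.List using (List; []; _∷_; map; upTo; filter; length; foldr; _++_)
open import Data.List.Membership.Propositional.Properties using (∈-map⁺; ∈-map⁻; ∈-upTo⁺; ∈-upTo⁻)
open import Data.List.Relation.Unary.Any using (here; there)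
open import Data.List.Relation.Unary.All using (All; []; _∷_)
open import Data.List.Membership.Propositional using (_∈_; _∉_)
open import Data.Bool using (Bool; true; false; if_then_else_)
open import Data.List.Properties using (upTo-∷ʳ; map-++; map-cong)
open import Data.Product using (Σ; _×_; _,_; proj₁; proj₂)
open import Data.Sum using (_⊎_; inj₁; inj₂)
open import Data.Empty using (⊥; ⊥-elim)
open import Function using (_∘_; case_of_)
open import Data.Fin using (Fin; toℕ; fromℕ<)
open import Data.Fin.Properties using (injective⇒≤; toℕ<n; toℕ-fromℕ<; toℕ-injective)
open import Induction.WellFounded using (Acc; acc)
open import Data.Nat.Induction using (<-wellFounded)
open import Relation.Nullary using (¬_; Dec; yes; no; does)
open import Relation.Nullary.Decidable using (_×-dec_; _⊎-dec_; ¬?)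
open import Relation.Unary using (Decidable)
open import Relation.Binary.PropositionalEquality
open import Relation.Binary.Definitions using (tri<; tri≈; tri>)
open import Algebra.Definitions (_≡_ {A = ℕ}) using (Involutive)

variable
  P Q : Set

data S-View (i j sⱼ : ℕ) : Set where
  at-i   : j ≡ i → sⱼ ≡ suc i → S-View i j sⱼ
  at-suc : j ≡ suc i → sⱼ ≡ i → S-View i j sⱼ
  away   : j ≢ i → j ≢ suc i → sⱼ ≡ j → S-View i j sⱼ

s-view : ∀ i j → S-View i j (s i j)
s-view i j with j ≟ i
... | yes j≡i = at-i j≡i refl
... | no j≢i with j ≟ suc i
...   | yes j≡1+i = at-suc j≡1+i refl
...   | no j≢1+i  = away j≢i j≢1+i refl

s-at-i : ∀ i → s i i ≡ suc i
s-at-i i with s-view i i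
... | at-i _ e         = e
... | at-suc i≡1+i _   = ⊥-elim (1+n≢n (sym i≡1+i))
... | away i≢i _ _     = ⊥-elim (i≢i refl)

s-at-suc : ∀ i → s i (suc i) ≡ i
s-at-suc i with s-view i (suc i)
... | at-i 1+i≡i _     = ⊥-elim (1+n≢n 1+i≡i)
... | at-suc _ e       = e
... | away _ 1+i≢1+i _ = ⊥-elim (1+i≢1+i refl)

s-away : ∀ i j → j ≢ i → j ≢ suc i → s i j ≡ j
s-away i j j≢i j≢1+i with s-view i j
... | at-i j≡i _     = ⊥-elim (j≢i j≡i)
... | at-suc j≡1+i _ = ⊥-elim (j≢1+i j≡1+i)
... | away _ _ e     = e

s-involutive : ∀ i j → s i (s i j) ≡ j
s-involutive i j with s-view i j
... | at-i refl e   = trans (cong (s i) e) (s-at-suc i)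
... | at-suc refl e = trans (cong (s i) e) (s-at-i i)
... | away _ _ e    = trans (cong (s i) e) e

s-injective : ∀ i {a b} → s i a ≡ s i b → a ≡ b
s-injective i {a} {b} e = trans (sym (s-involutive i a)) (trans (cong (s i) e) (s-involutive i b))

s-above : ∀ i j → suc i < j → s i j ≡ j
s-above i j 1+i<j = s-away i j (λ j≡i → <-irrefl (sym j≡i) (<-trans (n<1+n i) 1+i<j))
                               (λ j≡1+i → <-irrefl (sym j≡1+i) 1+i<j)

s-below : ∀ i j → j < i → s i j ≡ j
s-below i j j<i = s-away i j (λ j≡i → <-irrefl j≡i j<i) (λ j≡1+i → <-irrefl j≡1+i (<-trans j<i (n<1+n i)))

s-positive : ∀ i j → 1 ≤ i → 1 ≤ j → 1 ≤ s i j
s-positive i j 1≤i 1≤j with s-view i j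
... | at-i _ e   = subst (1 ≤_) (sym e) (s≤s z≤n)
... | at-suc _ e = subst (1 ≤_) (sym e) 1≤i
... | away _ _ e = subst (1 ≤_) (sym e) 1≤j

s-mono-< : ∀ i {a b} → a < b → ¬ (a ≡ i × b ≡ suc i) → s i a < s i b
s-mono-< i {a} {b} a<b not-i,1+i with s-view i a | s-view i b
... | at-i refl ea   | at-i refl _    = ⊥-elim (<-irrefl refl a<b)
... | at-i refl _    | at-suc refl _  = ⊥-elim (not-i,1+i (refl , refl))
... | at-i refl ea   | away _ b≢1+i eb =
  subst₂ _<_ (sym ea) (sym eb) (≤∧≢⇒< a<b (λ e → b≢1+i (sym e)))
... | at-suc refl _  | at-i refl _    = ⊥-elim (<-asym a<b (n<1+n i))
... | at-suc refl _  | at-suc refl _  = ⊥-elim (<-irrefl refl a<b)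
... | at-suc refl ea | away _ _ eb    = subst₂ _<_ (sym ea) (sym eb) (<-trans (n<1+n i) a<b)
... | away _ _ ea    | at-i refl eb   = subst₂ _<_ (sym ea) (sym eb) (<-trans a<b (n<1+n i))
... | away a≢i _ ea  | at-suc refl eb = subst₂ _<_ (sym ea) (sym eb) (≤∧≢⇒< (≤-pred a<b) a≢i)
... | away _ _ ea    | away _ _ eb    = subst₂ _<_ (sym ea) (sym eb) a<b

s-reflects-< : ∀ i {a b} → s i a < s i b → ¬ (a ≡ suc i × b ≡ i) → a < b
s-reflects-< i {a} {b} sa<sb not-1+i,i =
  subst₂ _<_ (s-involutive i a) (s-involutive i b) (s-mono-< i sa<sb not-swapped)
  where
    not-swapped : ¬ (s i a ≡ i × s i b ≡ suc i)
    not-swapped (ea , eb) = not-1+i,i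
      ( trans (sym (s-involutive i a)) (trans (cong (s i) ea) (s-at-i i))
      , trans (sym (s-involutive i b)) (trans (cong (s i) eb) (s-at-suc i)))

𝟙 : Dec P → ℕ
𝟙 (yes _) = 1
𝟙 (no _)  = 0

𝟙-mono : (P? : Dec P) (Q? : Dec Q) → (P → Q) → 𝟙 P? ≤ 𝟙 Q?
𝟙-mono (yes p) (yes _) _   = ≤-refl
𝟙-mono (yes p) (no ¬q) p→q = ⊥-elim (¬q (p→q p))
𝟙-mono (no _)  _       _   = z≤n

𝟙-cong : (P? : Dec P) (Q? : Dec Q) → (P → Q) → (Q → P) → 𝟙 P? ≡ 𝟙 Q?
𝟙-cong P? Q? p→q q→p = ≤-antisym (𝟙-mono P? Q? p→q) (𝟙-mono Q? P? q→p)

𝟙-< : (P? : Dec P) (Q? : Dec Q) → ¬ P → Q → 𝟙 P? < 𝟙 Q?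
𝟙-< (yes p) _       ¬p _ = ⊥-elim (¬p p)
𝟙-< (no _)  (yes _) _  _ = s≤s z≤n
𝟙-< (no _)  (no ¬q) _  q = ⊥-elim (¬q q)

𝟙≤1 : (P? : Dec P) → 𝟙 P? ≤ 1
𝟙≤1 (yes _) = ≤-refl
𝟙≤1 (no _)  = z≤n

𝟙-yes : (P? : Dec P) → P → 𝟙 P? ≡ 1
𝟙-yes (yes _) _ = refl
𝟙-yes (no ¬p) p = ⊥-elim (¬p p)

𝟙-no : (P? : Dec P) → ¬ P → 𝟙 P? ≡ 0
𝟙-no (yes p) ¬p = ⊥-elim (¬p p)
𝟙-no (no _)  _  = refl

length-filter≡sum-𝟙 : {P : ℕ → Set} (P? : Decidable P) (xs : List ℕ) →
  length (filter P? xs) ≡ sum (map (λ x → 𝟙 (P? x)) xs)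
length-filter≡sum-𝟙 P? []       = refl
length-filter≡sum-𝟙 P? (x ∷ xs) with P? x
... | yes _ = cong suc (length-filter≡sum-𝟙 P? xs)
... | no _  = length-filter≡sum-𝟙 P? xs

sumTo : ℕ → (ℕ → ℕ) → ℕ
sumTo zero    g = 0
sumTo (suc n) g = sumTo n g + g (suc n)

sum-[1‥n]≡sumTo : ∀ n g → sum (map g [1‥ n ]) ≡ sumTo n g
sum-[1‥n]≡sumTo zero    g = refl
sum-[1‥n]≡sumTo (suc n) g = begin
  sum (map g (map suc (upTo (suc n))))
    ≡⟨ cong (λ xs → sum (map g (map suc xs))) (sym (upTo-∷ʳ n)) ⟩
  sum (map g (map suc (upTo n ++ n ∷ [])))
    ≡⟨ cong (λ xs → sum (map g xs)) (map-++ suc (upTo n) (n ∷ [])) ⟩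
  sum (map g ([1‥ n ] ++ suc n ∷ []))
    ≡⟨ cong sum (map-++ g [1‥ n ] (suc n ∷ [])) ⟩
  sum (map g [1‥ n ] ++ g (suc n) ∷ [])
    ≡⟨ sum-++ (map g [1‥ n ]) (g (suc n) ∷ []) ⟩
  sum (map g [1‥ n ]) + (g (suc n) + 0)
    ≡⟨ cong₂ _+_ (sum-[1‥n]≡sumTo n g) (+-identityʳ (g (suc n))) ⟩
  sumTo n g + g (suc n) ∎
  where open ≡-Reasoning

OnRange : ℕ → (ℕ → Set) → Set
OnRange n R = ∀ x → 1 ≤ x → x ≤ n → R x

private
  restrict : ∀ {n R} → OnRange (suc n) R → OnRange n R
  restrict h x 1≤x x≤n = h x 1≤x (m≤n⇒m≤1+n x≤n)

  top : ∀ {n R} → OnRange (suc n) R → R (suc n)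
  top h = h _ (s≤s z≤n) ≤-refl

sumTo-cong : ∀ n {g h} → OnRange n (λ x → g x ≡ h x) → sumTo n g ≡ sumTo n h
sumTo-cong zero    _  = refl
sumTo-cong (suc n) eq = cong₂ _+_ (sumTo-cong n (restrict eq)) (top eq)

sumTo-mono : ∀ n {g h} → OnRange n (λ x → g x ≤ h x) → sumTo n g ≤ sumTo n h
sumTo-mono zero    _  = z≤n
sumTo-mono (suc n) le = +-mono-≤ (sumTo-mono n (restrict le)) (top le)

sumTo-mono-< : ∀ n {g h} → OnRange n (λ x → g x ≤ h x) →
  ∀ y → 1 ≤ y → y ≤ n → g y < h y → sumTo n g < sumTo n h
sumTo-mono-< zero    le y 1≤y y≤0 _ = ⊥-elim (<-irrefl refl (≤-trans 1≤y y≤0))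
sumTo-mono-< (suc n) le y 1≤y y≤1+n gy<hy with m≤n⇒m<n∨m≡n y≤1+n
... | inj₁ y<1+n = +-mono-<-≤ (sumTo-mono-< n (restrict le) y 1≤y (≤-pred y<1+n) gy<hy) (top le)
... | inj₂ refl  = +-mono-≤-< (sumTo-mono n (restrict le)) gy<hy

sumTo-zero : ∀ n {g} → OnRange n (λ x → g x ≡ 0) → sumTo n g ≡ 0
sumTo-zero n {g} eq = trans (sumTo-cong n {g} {λ _ → 0} eq) (zeros n)
  where
    zeros : ∀ n → sumTo n (λ _ → 0) ≡ 0
    zeros zero    = refl
    zeros (suc n) = cong (_+ 0) (zeros n)

sumTo-const : ∀ n m → sumTo n (λ _ → m) ≡ n * m
sumTo-const zero    m = refl
sumTo-const (suc n) m = trans (cong (_+ m) (sumTo-const n m)) (+-comm (n * m) m)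

sumTo-≤ : ∀ n m {g} → (∀ x → g x ≤ m) → sumTo n g ≤ n * m
sumTo-≤ n m {g} le = subst (sumTo n g ≤_) (sumTo-const n m) (sumTo-mono n (λ x _ _ → le x))

sumTo-𝟙≤n : ∀ n {P : ℕ → Set} (P? : Decidable P) → sumTo n (λ x → 𝟙 (P? x)) ≤ n
sumTo-𝟙≤n n P? = subst (sumTo n (λ x → 𝟙 (P? x)) ≤_) (*-identityʳ n) (sumTo-≤ n 1 (λ x → 𝟙≤1 (P? x)))

sumTo-s : ∀ i n g → 1 ≤ i → suc i ≤ n → sumTo n (λ x → g (s i x)) ≡ sumTo n g
sumTo-s (suc k) n g _ 2+k≤n =
  subst (λ n → sumTo n (λ x → g (s (suc k) x)) ≡ sumTo n g) (m∸n+n≡m 2+k≤n) (shifted (n ∸ suc (suc k)))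
  where
    i = suc k
    shifted : ∀ m → sumTo (m + suc i) (λ x → g (s i x)) ≡ sumTo (m + suc i) g
    shifted zero = begin
      (sumTo k (λ x → g (s i x)) + g (s i i)) + g (s i (suc i))
        ≡⟨ cong₂ (λ a b → (a + g b) + g (s i (suc i)))
                 (sumTo-cong k (λ x _ x≤k → cong g (s-below i x (s≤s x≤k)))) (s-at-i i) ⟩
      (sumTo k g + g (suc i)) + g (s i (suc i))
        ≡⟨ cong (λ b → (sumTo k g + g (suc i)) + g b) (s-at-suc i) ⟩
      (sumTo k g + g (suc i)) + g i
        ≡⟨ +-assoc (sumTo k g) _ _ ⟩
      sumTo k g + (g (suc i) + g i)
        ≡⟨ cong (sumTo k g +_) (+-comm (g (suc i)) (g i)) ⟩
      sumTo k g + (g i + g (suc i))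
        ≡⟨ sym (+-assoc (sumTo k g) _ _) ⟩
      (sumTo k g + g i) + g (suc i) ∎
      where open ≡-Reasoning
    shifted (suc m) = cong₂ _+_ (shifted m) (cong g (s-above i _ (s≤s (m≤n+m (suc i) m))))

inversion : (ℕ → ℕ) → ℕ → ℕ → ℕ
inversion f x y = 𝟙 ((x <? y) ×-dec (f y <? f x))

inversions : ℕ → (ℕ → ℕ) → ℕ
inversions N f = sumTo N (λ y → sumTo N (λ x → inversion f x y))

invs≡inversions : ∀ n f → invs n f ≡ inversions n f
invs≡inversions n f = begin
  sum (map (λ y → length (filter (λ x → (x <? y) ×-dec (f y <? f x)) [1‥ n ])) [1‥ n ])
    ≡⟨ cong sum (map-cong row [1‥ n ]) ⟩
  sum (map (λ y → sumTo n (λ x → inversion f x y)) [1‥ n ])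
    ≡⟨ sum-[1‥n]≡sumTo n _ ⟩
  inversions n f ∎
  where
    open ≡-Reasoning
    row : ∀ y → length (filter (λ x → (x <? y) ×-dec (f y <? f x)) [1‥ n ]) ≡ sumTo n (λ x → inversion f x y)
    row y = trans (length-filter≡sum-𝟙 (λ x → (x <? y) ×-dec (f y <? f x)) [1‥ n ])
                  (sum-[1‥n]≡sumTo n (λ x → inversion f x y))

inversions-cong : ∀ N {f g} → (∀ x → f x ≡ g x) → inversions N f ≡ inversions N g
inversions-cong N eq = sumTo-cong N λ y _ _ → sumTo-cong N λ x _ _ → 𝟙-cong _ _
  (λ (x<y , fy<fx) → x<y , subst₂ _<_ (eq y) (eq x) fy<fx)
  (λ (x<y , gy<gx) → x<y , subst₂ _<_ (sym (eq y)) (sym (eq x)) gy<gx)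

inversions-≤ : ∀ N f → inversions N f ≤ N * N
inversions-≤ N f = sumTo-≤ N N λ y → sumTo-𝟙≤n N (λ x → (x <? y) ×-dec (f y <? f x))

inversions-suc : ∀ K f → f (suc K) ≡ suc K → (∀ x → x ≤ K → f x ≤ K) →
  inversions (suc K) f ≡ inversions K f
inversions-suc K f fixes-1+K maps-into-K = begin
  sumTo K (λ y → sumTo K (λ x → inversion f x y) + inversion f (suc K) y)
    + sumTo (suc K) (λ x → inversion f x (suc K))
    ≡⟨ cong₂ _+_ (sumTo-cong K λ y _ y≤K → trans (cong (sumTo K (λ x → inversion f x y) +_) (no-row y≤K)) (+-identityʳ _))
                 (sumTo-zero (suc K) λ x _ _ → no-column x) ⟩
  inversions K f + 0
    ≡⟨ +-identityʳ _ ⟩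
  inversions K f ∎
  where
    open ≡-Reasoning
    no-row : ∀ {y} → y ≤ K → inversion f (suc K) y ≡ 0
    no-row y≤K = 𝟙-no _ λ (1+K<y , _) → <-irrefl refl (<-trans (s≤s y≤K) 1+K<y)
    no-column : ∀ x → inversion f x (suc K) ≡ 0
    no-column x = 𝟙-no _ λ (x<1+K , f1+K<fx) →
      <-irrefl refl (<-≤-trans (subst (_< f x) fixes-1+K f1+K<fx)
                               (≤-trans (maps-into-K x (≤-pred x<1+K)) (n≤1+n K)))

fun-≤-bound : ∀ π {x} → x ≤ bound π → fun π x ≤ bound π
fun-≤-bound π {x} x≤b with fun π x ≤? bound π
... | yes πx≤b = πx≤b
... | no πx≰b  = ⊥-elim (πx≰b (subst (_≤ bound π) (sym πx≡x) x≤b))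
  where
    πx≡x : fun π x ≡ x
    πx≡x = sym (injective π x (fun π x) (sym (fix-above π (fun π x) (≰⇒> πx≰b))))

fun-≤ : ∀ π {K x} → bound π ≤ K → x ≤ K → fun π x ≤ K
fun-≤ π {K} {x} b≤K x≤K with x ≤? bound π
... | yes x≤b = ≤-trans (fun-≤-bound π x≤b) b≤K
... | no x≰b  = subst (_≤ K) (sym (fix-above π x (≰⇒> x≰b))) x≤K

ℓ≡inversions : ∀ π N → bound π ≤ N → ℓ π ≡ inversions N (fun π)
ℓ≡inversions π N b≤N = begin
  invs (bound π) (fun π)                   ≡⟨ invs≡inversions (bound π) (fun π) ⟩
  inversions (bound π) (fun π)             ≡⟨ sym (padded (N ∸ bound π)) ⟩
  inversions (N ∸ bound π + bound π) (fun π) ≡⟨ cong (λ K → inversions K (fun π)) (m∸n+n≡m b≤N) ⟩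
  inversions N (fun π)                     ∎
  where
    open ≡-Reasoning
    padded : ∀ k → inversions (k + bound π) (fun π) ≡ inversions (bound π) (fun π)
    padded zero    = refl
    padded (suc k) = trans (inversions-suc (k + bound π) (fun π)
                              (fix-above π _ (s≤s (m≤n+m (bound π) k)))
                              (λ x → fun-≤ π (m≤n+m (bound π) k)))
                           (padded k)

-- The excluded case, i and i + 1 both fixed, is the one where s_i commutes with f.
NontrivialAscent : (ℕ → ℕ) → ℕ → Set
NontrivialAscent f i = f i < f (suc i) × ¬ (f i ≡ i × f (suc i) ≡ suc i)

-- Every inversion (x, y) of v yields the inversion (s_i x, s_i y) of u = s_i v s_i, and (i, i+1)
-- is an inversion of u but not of v.
inversions-conj-ascent : ∀ N i {v u} → 1 ≤ i → suc i ≤ N → Involutive v →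
  (∀ j → u j ≡ s i (v (s i j))) → NontrivialAscent v i → inversions N v < inversions N u
inversions-conj-ascent N i {v} {u} 1≤i 1+i≤N v-inv u≡svs (asc , nontrivial) =
  subst (inversions N v <_) (sym reindexed) (sumTo-mono-< N (λ y _ _ → sumTo-mono N (λ x _ _ → transported x y))
    i 1≤i (≤-trans (n≤1+n i) 1+i≤N)
    (sumTo-mono-< N (λ x _ _ → transported x i) (suc i) (s≤s z≤n) 1+i≤N new))
  where
    reindexed : inversions N u ≡ sumTo N (λ y → sumTo N (λ x → inversion u (s i x) (s i y)))
    reindexed = trans (sumTo-cong N (λ y _ _ → sym (sumTo-s i N (λ x → inversion u x y) 1≤i 1+i≤N)))
                      (sym (sumTo-s i N (λ y → sumTo N (λ x → inversion u (s i x) y)) 1≤i 1+i≤N))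
    us≡sv : ∀ y → u (s i y) ≡ s i (v y)
    us≡sv y = trans (u≡svs (s i y)) (cong (λ t → s i (v t)) (s-involutive i y))
    transported : ∀ x y → inversion v x y ≤ inversion u (s i x) (s i y)
    transported x y = 𝟙-mono _ _ λ (x<y , vy<vx) →
      s-mono-< i x<y (λ { (refl , refl) → <-asym vy<vx asc }) ,
      subst₂ _<_ (sym (us≡sv y)) (sym (us≡sv x))
        (s-mono-< i vy<vx λ (vy≡i , vx≡1+i) →
          <-asym (subst₂ _<_ (trans (sym (v-inv x)) (cong v vx≡1+i)) (trans (sym (v-inv y)) (cong v vy≡i)) x<y) asc)
    new : inversion v (suc i) i < inversion u (s i (suc i)) (s i i)
    new = subst₂ (λ a b → inversion v (suc i) i < inversion u a b) (sym (s-at-suc i)) (sym (s-at-i i))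
      (𝟙-< _ _ (λ (1+i<i , _) → <-asym 1+i<i (n<1+n i))
        (n<1+n i , subst₂ _<_ (sym (trans (u≡svs (suc i)) (cong (λ t → s i (v t)) (s-at-suc i))))
                              (sym (trans (u≡svs i) (cong (λ t → s i (v t)) (s-at-i i))))
                              (s-mono-< i asc nontrivial)))

-- i + 1 ≤ bound z makes bound z a valid bound for s_i z s_i as well.
conjugate : (z : Perm) (i : ℕ) → 1 ≤ i → suc i ≤ bound z → Perm
conjugate z i 1≤i 1+i≤b = record
  { fun       = λ j → s i (fun z (s i j))
  ; bound     = bound z
  ; fix-zero  = trans (cong (λ t → s i (fun z t)) (s-below i 0 1≤i))
                      (trans (cong (s i) (fix-zero z)) (s-below i 0 1≤i))
  ; fix-above = λ j b<j → let s-fixes-j = s-above i j (<-≤-trans (s≤s 1+i≤b) b<j) in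
                  trans (cong (λ t → s i (fun z t)) s-fixes-j) (trans (cong (s i) (fix-above z j b<j)) s-fixes-j)
  ; injective = λ a b e → s-injective i (injective z _ _ (s-injective i e))
  }

conjugate-involution : ∀ z i 1≤i 1+i≤b → IsInvolution z → IsInvolution (conjugate z i 1≤i 1+i≤b)
conjugate-involution z i _ _ z-inv j =
  trans (cong (λ t → s i (fun z t)) (s-involutive i _)) (trans (cong (s i) (z-inv _)) (s-involutive i j))

ℓ-conjugate-ascent : ∀ z i 1≤i 1+i≤b → IsInvolution z → NontrivialAscent (fun z) i →
  ℓ z < ℓ (conjugate z i 1≤i 1+i≤b)
ℓ-conjugate-ascent z i 1≤i 1+i≤b z-inv asc =
  subst₂ _<_ (sym (ℓ≡inversions z (bound z) ≤-refl)) (sym (ℓ≡inversions (conjugate z i 1≤i 1+i≤b) (bound z) ≤-refl))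
    (inversions-conj-ascent (bound z) i 1≤i 1+i≤b z-inv (λ _ → refl) asc)

s-conj-trivial : ∀ f i → Involutive f → f i ≡ suc i → ∀ j → s i (f (s i j)) ≡ f j
s-conj-trivial f i f-inv fi≡1+i j with s-view i j
... | at-i refl e   = trans (cong (λ t → s i (f t)) e)
                        (trans (cong (s i) f1+i≡i) (trans (s-at-i i) (sym fi≡1+i)))
  where f1+i≡i = trans (cong f (sym fi≡1+i)) (f-inv i)
... | at-suc refl e = trans (cong (λ t → s i (f t)) e)
                        (trans (cong (s i) fi≡1+i) (trans (s-at-suc i) (sym (trans (cong f (sym fi≡1+i)) (f-inv i)))))
... | away j≢i j≢1+i e = trans (cong (λ t → s i (f t)) e) (s-away i (f j) fj≢i fj≢1+i)
  where
    fj≢i : f j ≢ i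
    fj≢i fj≡i = j≢1+i (trans (sym (f-inv j)) (trans (cong f fj≡i) fi≡1+i))
    fj≢1+i : f j ≢ suc i
    fj≢1+i fj≡1+i = j≢i (trans (sym (f-inv j)) (trans (cong f fj≡1+i) (trans (cong f (sym fi≡1+i)) (f-inv i))))

s-opener-iff : ∀ f i → Involutive f → f i ≢ suc i → ∀ x →
  (x < f x → s i x < s i (f x)) × (s i x < s i (f x) → x < f x)
s-opener-iff f i f-inv fi≢1+i x =
  (λ x<fx → s-mono-< i x<fx (λ { (refl , e) → fi≢1+i e })) ,
  (λ sx<sfx → s-reflects-< i sx<sfx (λ { (refl , e) → fi≢1+i (trans (cong f (sym e)) (f-inv (suc i))) }))

pOf≡sumTo : ∀ z → pOf z ≡ sumTo (bound z) (λ j → 𝟙 (j <? fun z j))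
pOf≡sumTo z = trans (length-filter≡sum-𝟙 (λ j → j <? fun z j) [1‥ bound z ]) (sum-[1‥n]≡sumTo (bound z) _)

pOf-≤-bound : ∀ z → pOf z ≤ bound z
pOf-≤-bound z = subst (_≤ bound z) (sym (pOf≡sumTo z)) (sumTo-𝟙≤n (bound z) (λ j → j <? fun z j))

pOf-conjugate : ∀ z i 1≤i 1+i≤b → IsInvolution z → pOf (conjugate z i 1≤i 1+i≤b) ≡ pOf z
pOf-conjugate z i 1≤i 1+i≤b z-inv with fun z i ≟ suc i
... | yes zi≡1+i = trans (pOf≡sumTo (conjugate z i 1≤i 1+i≤b)) (trans
        (sumTo-cong (bound z) λ j _ _ → 𝟙-cong _ _
          (subst (j <_) (s-conj-trivial (fun z) i z-inv zi≡1+i j)) (subst (j <_) (sym (s-conj-trivial (fun z) i z-inv zi≡1+i j))))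
        (sym (pOf≡sumTo z)))
... | no zi≢1+i = trans (pOf≡sumTo (conjugate z i 1≤i 1+i≤b)) (trans
        (sumTo-cong (bound z) λ j _ _ → 𝟙-cong _ _ (backward j) (forward j))
        (trans (sumTo-s i (bound z) (λ x → 𝟙 (x <? fun z x)) 1≤i 1+i≤b) (sym (pOf≡sumTo z))))
  where
    forward : ∀ j → s i j < fun z (s i j) → j < s i (fun z (s i j))
    forward j lt = subst (_< s i (fun z (s i j))) (s-involutive i j) (proj₁ (s-opener-iff (fun z) i z-inv zi≢1+i (s i j)) lt)
    backward : ∀ j → j < s i (fun z (s i j)) → s i j < fun z (s i j)
    backward j lt = proj₂ (s-opener-iff (fun z) i z-inv zi≢1+i (s i j))
                      (subst (_< s i (fun z (s i j))) (sym (s-involutive i j)) lt)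

∈-[1‥]⁺ : ∀ {n j} → 1 ≤ j → j ≤ n → j ∈ [1‥ n ]
∈-[1‥]⁺ {j = suc j} _ 1+j≤n = ∈-map⁺ suc (∈-upTo⁺ 1+j≤n)

∈-[1‥]⁻ : ∀ {n j} → j ∈ [1‥ n ] → 1 ≤ j × j ≤ n
∈-[1‥]⁻ j∈ with ∈-map⁻ suc j∈
... | _ , x∈ , refl = s≤s z≤n , ∈-upTo⁻ x∈

module _ (z : Perm) where
  private
    lastMoved : List ℕ → ℕ
    lastMoved = foldr (λ i m → if does (fun z i ≟ i) then m else (i ⊔ m)) 0

    -- does (m ≟ n) computes to m ≡ᵇ n, so case splits on fixed points go through this view.
    data FixedView (i : ℕ) : Bool → Set where
      fixed : fun z i ≡ i → FixedView i true
      moved : fun z i ≢ i → FixedView i false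

    fixed? : ∀ i → FixedView i (fun z i ≡ᵇ i)
    fixed? i with fun z i ≡ᵇ i | ≡ᵇ⇒≡ (fun z i) i | ≡⇒≡ᵇ (fun z i) i
    ... | true  | to≡ | _    = fixed (to≡ _)
    ... | false | _   | from≡ = moved from≡

    lastMoved-≥ : ∀ xs {j} → j ∈ xs → fun z j ≢ j → j ≤ lastMoved xs
    lastMoved-≥ (i ∷ xs) (here refl) zj≢j with fun z i ≡ᵇ i | fixed? i
    ... | true  | fixed zj≡j = ⊥-elim (zj≢j zj≡j)
    ... | false | moved _    = m≤m⊔n i _
    lastMoved-≥ (i ∷ xs) (there j∈) zj≢j with fun z i ≡ᵇ i | fixed? i
    ... | true  | fixed _ = lastMoved-≥ xs j∈ zj≢j
    ... | false | moved _ = ≤-trans (lastMoved-≥ xs j∈ zj≢j) (m≤n⊔m i _)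

    lastMoved-moved : ∀ xs → lastMoved xs ≡ 0 ⊎ (lastMoved xs ∈ xs × fun z (lastMoved xs) ≢ lastMoved xs)
    lastMoved-moved [] = inj₁ refl
    lastMoved-moved (i ∷ xs) with fun z i ≡ᵇ i | fixed? i
    ... | true | fixed _ with lastMoved-moved xs
    ...   | inj₁ e          = inj₁ e
    ...   | inj₂ (∈xs , mv) = inj₂ (there ∈xs , mv)
    lastMoved-moved (i ∷ xs) | false | moved zi≢i with ≤-total i (lastMoved xs)
    ...   | inj₂ i≥m rewrite m≥n⇒m⊔n≡m i≥m = inj₂ (here refl , zi≢i)
    ...   | inj₁ i≤m rewrite m≤n⇒m⊔n≡n i≤m with lastMoved-moved xs
    ...     | inj₁ e          = inj₁ e
    ...     | inj₂ (∈xs , mv) = inj₂ (there ∈xs , mv)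

  fixed-above-qOf : ∀ j → qOf z < j → fun z j ≡ j
  fixed-above-qOf j q<j with fun z j ≟ j
  ... | yes zj≡j = zj≡j
  ... | no zj≢j with j ≤? bound z
  ...   | yes j≤b = ⊥-elim (<-irrefl refl (<-≤-trans q<j
                        (lastMoved-≥ [1‥ bound z ] (∈-[1‥]⁺ (≤-trans (s≤s z≤n) q<j) j≤b) zj≢j)))
  ...   | no j≰b  = fix-above z j (≰⇒> j≰b)

  qOf-moved : qOf z ≡ 0 ⊎ (1 ≤ qOf z × qOf z ≤ bound z × fun z (qOf z) ≢ qOf z)
  qOf-moved with lastMoved-moved [1‥ bound z ]
  ... | inj₁ q≡0        = inj₁ q≡0
  ... | inj₂ (q∈ , mv) = inj₂ (proj₁ (∈-[1‥]⁻ q∈) , proj₂ (∈-[1‥]⁻ q∈) , mv)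

  qOf-≤-bound : qOf z ≤ bound z
  qOf-≤-bound with qOf-moved
  ... | inj₁ q≡0          = subst (_≤ bound z) (sym q≡0) z≤n
  ... | inj₂ (_ , q≤b , _) = q≤b

  qOf-unique : ∀ q → (∀ j → q < j → fun z j ≡ j) → q ≡ 0 ⊎ fun z q ≢ q → qOf z ≡ q
  qOf-unique q fixed-above q-moved with <-cmp (qOf z) q
  ... | tri≈ _ e _ = e
  ... | tri< qOf<q _ _ with q-moved
  ...   | inj₁ refl  = ⊥-elim (<-irrefl refl (≤-<-trans z≤n qOf<q))
  ...   | inj₂ zq≢q  = ⊥-elim (zq≢q (fixed-above-qOf q qOf<q))
  qOf-unique q fixed-above q-moved | tri> _ _ q<qOf with qOf-moved
  ... | inj₁ qOf≡0         = ⊥-elim (<-irrefl (sym qOf≡0) (≤-<-trans z≤n q<qOf))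
  ... | inj₂ (_ , _ , mv) = ⊥-elim (mv (fixed-above (qOf z) q<qOf))

fun-qOf-< : ∀ z → IsInvolution z → fun z (qOf z) ≢ qOf z → fun z (qOf z) < qOf z
fun-qOf-< z z-inv zq≢q with <-cmp (fun z (qOf z)) (qOf z)
... | tri< zq<q _ _ = zq<q
... | tri≈ _ zq≡q _ = ⊥-elim (zq≢q zq≡q)
... | tri> _ _ q<zq = ⊥-elim (zq≢q (sym (trans (sym (z-inv (qOf z))) (fixed-above-qOf z _ q<zq))))

qOf-conjugate : ∀ z i 1≤i 1+i≤b → IsInvolution z → suc i ≤ qOf z → fun z i < fun z (suc i) →
  qOf (conjugate z i 1≤i 1+i≤b) ≡ qOf z
qOf-conjugate z i 1≤i 1+i≤b z-inv 1+i≤q asc = qOf-unique (conjugate z i 1≤i 1+i≤b) q fixed-above (inj₂ moved)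
  where
    q = qOf z
    fixed-above : ∀ j → q < j → s i (fun z (s i j)) ≡ j
    fixed-above j q<j = let s-fixes-j = s-above i j (<-≤-trans (s≤s 1+i≤q) q<j) in
      trans (cong (λ t → s i (fun z t)) s-fixes-j) (trans (cong (s i) (fixed-above-qOf z j q<j)) s-fixes-j)
    zq≢q : fun z q ≢ q
    zq≢q with qOf-moved z
    ... | inj₁ q≡0              = ⊥-elim (<-irrefl (sym q≡0) (≤-trans (s≤s z≤n) 1+i≤q))
    ... | inj₂ (_ , _ , zq≢q′) = zq≢q′
    moved : s i (fun z (s i q)) ≢ q
    moved e with m≤n⇒m<n∨m≡n 1+i≤q
    ... | inj₁ 1+i<q = zq≢q (trans (sym (s-involutive i (fun z q)))
                              (trans (cong (s i) (trans (cong (λ t → s i (fun z t)) (sym (s-above i q 1+i<q))) e))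
                                     (s-above i q 1+i<q)))
    ... | inj₂ 1+i≡q = <-irrefl refl (<-≤-trans z1+i<1+i 1+i≤z1+i)
      where
        szi≡1+i : s i (fun z i) ≡ suc i
        szi≡1+i = trans (cong (λ t → s i (fun z t)) (sym (trans (cong (s i) (sym 1+i≡q)) (s-at-suc i)))) (trans e (sym 1+i≡q))
        zi≡i : fun z i ≡ i
        zi≡i = trans (sym (s-involutive i (fun z i))) (trans (cong (s i) szi≡1+i) (s-at-suc i))
        z1+i<1+i : fun z (suc i) < suc i
        z1+i<1+i = subst (λ t → fun z t < t) (sym 1+i≡q) (fun-qOf-< z z-inv zq≢q)
        1+i≤z1+i : suc i ≤ fun z (suc i)
        1+i≤z1+i = subst (_< fun z (suc i)) zi≡i asc

Vexillary : (ℕ → ℕ) → Set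
Vexillary f = ∀ a b c d → 1 ≤ a → a < b → b < c → c < d → ¬ (f b < f a × f a < f d × f d < f c)

-- Swapping i and i+1 can only complete a 2143 through a pattern (a, b, i) with f b < f a < f i
-- or a pattern (i + 1, c, d) with f (i + 1) < f d < f c.
LeftClear : (ℕ → ℕ) → ℕ → Set
LeftClear f i = ∀ a b → 1 ≤ a → a < b → b < i → ¬ (f b < f a × f a < f i)

RightClear : (ℕ → ℕ) → ℕ → Set
RightClear f i = ∀ c d → suc i < c → c < d → ¬ (f (suc i) < f d × f d < f c)

module _ {z : ℕ → ℕ} {i : ℕ} (1≤i : 1 ≤ i) (z0≡0 : z 0 ≡ 0) (z-inv : Involutive z) (z-vex : Vexillary z)
         (asc : NontrivialAscent z i) (left : LeftClear z i) (right : RightClear z i) where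
  private
    w : ℕ → ℕ
    w j = s i (z (s i j))

    w-inv : Involutive w
    w-inv x = trans (cong (λ t → s i (z t)) (s-involutive i _))
                    (trans (cong (s i) (z-inv _)) (s-involutive i x))

    w0≡0 : w 0 ≡ 0
    w0≡0 = trans (cong (λ t → s i (z t)) (s-below i 0 1≤i)) (trans (cong (s i) z0≡0) (s-below i 0 1≤i))

    sw≡zs : ∀ x → s i (w x) ≡ z (s i x)
    sw≡zs x = s-involutive i _

    w-away : ∀ x → x ≢ i → x ≢ suc i → w x ≡ s i (z x)
    w-away x x≢i x≢1+i = cong (λ t → s i (z t)) (s-away i x x≢i x≢1+i)

    w-at-i : w i ≡ s i (z (suc i))
    w-at-i = cong (λ t → s i (z t)) (s-at-i i)

    w-at-suc : w (suc i) ≡ s i (z i)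
    w-at-suc = cong (λ t → s i (z t)) (s-at-suc i)

    z-flip : ∀ {x y} → z x ≡ y → x ≡ z y
    z-flip {x} e = trans (sym (z-inv x)) (cong z e)

    Pattern : ℕ → ℕ → ℕ → ℕ → Set
    Pattern a b c d = 1 ≤ a × a < b × b < c × c < d × (w b < w a × w a < w d × w d < w c)

    through-i : ∀ a b c d → Pattern a b c d →
      (a ≡ i × b ≡ suc i) ⊎ (b ≡ i × c ≡ suc i) ⊎ (c ≡ i × d ≡ suc i) → ⊥
    through-i a b c d (_ , _ , _ , _ , wb<wa , wa<wd , wd<wc) (inj₂ (inj₁ (refl , refl))) =
      <-asym (subst₂ _<_ (sym w-at-suc) (sym w-at-i) (s-mono-< i (proj₁ asc) (proj₂ asc)))
             (<-trans wb<wa (<-trans wa<wd wd<wc))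
    through-i a b c d (_ , _ , b<c , c<d , _ , wa<wd , wd<wc) (inj₁ (refl , refl)) =
      right c d b<c c<d (z1+i<zd , zd<zc)
      where
        i<c = <-trans (n<1+n i) b<c
        i<d = <-trans i<c c<d
        c≢i : c ≢ i
        c≢i e = <-irrefl (sym e) i<c
        c≢1+i : c ≢ suc i
        c≢1+i e = <-irrefl (sym e) b<c
        d≢i : d ≢ i
        d≢i e = <-irrefl (sym e) i<d
        d≢1+i : d ≢ suc i
        d≢1+i e = <-irrefl (sym e) (<-trans b<c c<d)
        z1+i<zd : z (suc i) < z d
        z1+i<zd = s-reflects-< i (subst₂ _<_ w-at-i (w-away d d≢i d≢1+i) wa<wd)
          λ (z1+i≡1+i , zd≡i) → <-irrefl refl
             (<-≤-trans i<d (≤-pred (subst₂ _<_ (sym (z-flip zd≡i)) z1+i≡1+i (proj₁ asc))))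
        zd<zc : z d < z c
        zd<zc = s-reflects-< i (subst₂ _<_ (w-away d d≢i d≢1+i) (w-away c c≢i c≢1+i) wd<wc)
          λ (zd≡1+i , _) → <-asym i<d (subst₂ _<_
             (trans w-at-i (trans (cong (s i) (sym (z-flip zd≡1+i))) (s-above i d (<-trans b<c c<d))))
             (trans (w-away d d≢i d≢1+i) (trans (cong (s i) zd≡1+i) (s-at-suc i))) wa<wd)
    through-i a b c d (1≤a , a<b , b<c , _ , wb<wa , wa<wd , wd<wc) (inj₂ (inj₂ (refl , refl))) =
      left a b 1≤a a<b b<c (zb<za , za<zc)
      where
        a<c = <-trans a<b b<c
        a≢i : a ≢ i
        a≢i e = <-irrefl e a<c
        a≢1+i : a ≢ suc i
        a≢1+i e = <-irrefl e (<-trans a<c (n<1+n c))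
        b≢i : b ≢ i
        b≢i e = <-irrefl e b<c
        b≢1+i : b ≢ suc i
        b≢1+i e = <-irrefl e (<-trans b<c (n<1+n c))
        zb<za : z b < z a
        zb<za = s-reflects-< i (subst₂ _<_ (w-away b b≢i b≢1+i) (w-away a a≢i a≢1+i) wb<wa)
          λ (_ , za≡i) → <-asym a<c (≤-trans (n≤1+n _) (subst₂ _<_
             (trans (w-away a a≢i a≢1+i) (trans (cong (s i) za≡i) (s-at-i i)))
             (trans w-at-suc (trans (cong (s i) (sym (z-flip za≡i))) (s-below i a a<c))) wa<wd))
        za<zc : z a < z c
        za<zc = s-reflects-< i (subst₂ _<_ (w-away a a≢i a≢1+i) w-at-suc wa<wd)
          λ (za≡1+i , zi≡i) → <-asym a<c (≤-trans (n≤1+n _) (subst₂ _<_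
             (trans w-at-suc (trans (cong (s i) zi≡i) (s-at-i i)))
             (trans w-at-i (trans (cong (s i) (sym (z-flip za≡1+i))) (s-below i a a<c))) wd<wc))

    -- w is an involution, so the values of a 2143 of w form again a 2143 of w.
    values-pattern : ∀ a b c d → Pattern a b c d → Pattern (w b) (w a) (w d) (w c)
    values-pattern a b c d (1≤a , a<b , b<c , c<d , wb<wa , wa<wd , wd<wc) =
      1≤wb , wb<wa , wa<wd , wd<wc ,
      subst₂ _<_ (sym (w-inv a)) (sym (w-inv b)) a<b ,
      subst₂ _<_ (sym (w-inv b)) (sym (w-inv c)) b<c ,
      subst₂ _<_ (sym (w-inv c)) (sym (w-inv d)) c<d
      where
        1≤wb : 1 ≤ w b
        1≤wb with w b ≟ 0
        ... | no wb≢0  = ≤∧≢⇒< z≤n (λ e → wb≢0 (sym e))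
        ... | yes wb≡0 = ⊥-elim (<-irrefl (sym (trans (sym (w-inv b)) (trans (cong w wb≡0) w0≡0)))
                                          (<-≤-trans 1≤a (<⇒≤ a<b)))

    adjacent-i? : ∀ x y → Dec (x ≡ i × y ≡ suc i)
    adjacent-i? x y = (x ≟ i) ×-dec (y ≟ suc i)

  conjugate-vexillary : Vexillary w
  conjugate-vexillary a b c d 1≤a a<b b<c c<d pat
    with adjacent-i? a b ⊎-dec adjacent-i? b c ⊎-dec adjacent-i? c d
  ... | yes adjacent = through-i a b c d (1≤a , a<b , b<c , c<d , pat) adjacent
  ... | no ¬adjacent with adjacent-i? (w b) (w a) ⊎-dec adjacent-i? (w a) (w d) ⊎-dec adjacent-i? (w d) (w c)
  ...   | yes adjacent = through-i _ _ _ _ (values-pattern a b c d (1≤a , a<b , b<c , c<d , pat)) adjacent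
  ...   | no ¬adjacent′ =
    z-vex (s i a) (s i b) (s i c) (s i d) (s-positive i a 1≤i 1≤a)
      (s-mono-< i a<b (¬adjacent ∘ inj₁)) (s-mono-< i b<c (¬adjacent ∘ inj₂ ∘ inj₁))
      (s-mono-< i c<d (¬adjacent ∘ inj₂ ∘ inj₂))
      ( subst₂ _<_ (sw≡zs b) (sw≡zs a) (s-mono-< i (proj₁ pat) (¬adjacent′ ∘ inj₁))
      , subst₂ _<_ (sw≡zs a) (sw≡zs d) (s-mono-< i (proj₁ (proj₂ pat)) (¬adjacent′ ∘ inj₂ ∘ inj₁))
      , subst₂ _<_ (sw≡zs d) (sw≡zs c) (s-mono-< i (proj₂ (proj₂ pat)) (¬adjacent′ ∘ inj₂ ∘ inj₂)))

last-below : ∀ (f : ℕ → ℕ) t {x} y → x < y → f x < t → ¬ f y < t →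
  Σ ℕ λ j → x ≤ j × j < y × f j < t × ¬ f (suc j) < t
last-below f t {x} (suc y) x<1+y fx<t ¬f1+y<t with f y <? t
... | yes fy<t = y , ≤-pred x<1+y , ≤-refl , fy<t , ¬f1+y<t
... | no ¬fy<t with m≤n⇒m<n∨m≡n (≤-pred x<1+y)
...   | inj₂ refl = ⊥-elim (¬fy<t fx<t)
...   | inj₁ x<y with last-below f t y x<y fx<t ¬fy<t
...     | j , x≤j , j<y , fj<t , ¬f1+j<t = j , x≤j , m<n⇒m<1+n j<y , fj<t , ¬f1+j<t

AscentBelow : (ℕ → ℕ) → ℕ → ℕ → Set
AscentBelow f q j = 1 ≤ j × j < q × NontrivialAscent f j

ascentBelow? : ∀ f q j → Dec (AscentBelow f q j)
ascentBelow? f q j = (1 ≤? j) ×-dec (j <? q) ×-dec (f j <? f (suc j)) ×-dec ¬? ((f j ≟ j) ×-dec (f (suc j) ≟ suc j))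

GoodAscent : (ℕ → ℕ) → ℕ → ℕ → Set
GoodAscent f q j = AscentBelow f q j × LeftClear f j × RightClear f j

module _ {f : ℕ → ℕ} {q : ℕ} (f-inv : Involutive f) (fixed-above : ∀ j → q < j → f j ≡ j)
         (f-vex : Vexillary f) where
  private
    f-injective : ∀ {x y} → f x ≡ f y → x ≡ y
    f-injective {x} {y} e = trans (sym (f-inv x)) (trans (cong f e) (f-inv y))

    no-value-between : ∀ {j t} → j < t → t < suc j → ⊥
    no-value-between j<t t<1+j = <-irrefl refl (<-≤-trans j<t (≤-pred t<1+j))

    crossing-ascent : ∀ {j a} → 1 ≤ j → j < q → a ≢ suc j → f j < f a → ¬ f (suc j) < f a → AscentBelow f q j
    crossing-ascent {j} {a} 1≤j j<q a≢1+j fj<fa ¬f1+j<fa =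
      1≤j , j<q , <-trans fj<fa fa<f1+j ,
      λ (fj≡j , f1+j≡1+j) → no-value-between (subst (_< f a) fj≡j fj<fa) (subst (f a <_) f1+j≡1+j fa<f1+j)
      where
        fa<f1+j : f a < f (suc j)
        fa<f1+j = ≤∧≢⇒< (≮⇒≥ ¬f1+j<fa) (a≢1+j ∘ f-injective)

    left-clear? : ∀ j → LeftClear f j ⊎ (Σ ℕ λ a → Σ ℕ λ b → 1 ≤ a × a < b × b < j × f b < f a × f a < f j)
    left-clear? j with anyUpTo? (λ b → anyUpTo? (λ a → (1 ≤? a) ×-dec ((f b <? f a) ×-dec (f a <? f j))) b) j
    ... | yes (b , b<j , a , a<b , 1≤a , fb<fa , fa<fj) = inj₂ (a , b , 1≤a , a<b , b<j , fb<fa , fa<fj)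
    ... | no none = inj₁ λ a b 1≤a a<b b<j pat → none (b , b<j , a , a<b , 1≤a , pat)

    -- beyond q the function is the identity, so a violation of RightClear lies within 1‥q
    right-clear? : ∀ j → RightClear f j ⊎
      (Σ ℕ λ c → Σ ℕ λ d → suc j < c × c < d × d ≤ q × f (suc j) < f d × f d < f c)
    right-clear? j with anyUpTo? (λ d → anyUpTo? (λ c → (suc j <? c) ×-dec ((f (suc j) <? f d) ×-dec (f d <? f c))) d) (suc q)
    ... | yes (d , d<1+q , c , c<d , 1+j<c , pat) = inj₂ (c , d , 1+j<c , c<d , ≤-pred d<1+q , pat)
    ... | no none = inj₁ clear
      where
        clear : RightClear f j
        clear c d 1+j<c c<d (f1+j<fd , fd<fc) with d ≤? q
        ... | yes d≤q = none (d , s≤s d≤q , c , c<d , 1+j<c , f1+j<fd , fd<fc)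
        ... | no d≰q with c ≤? q
        ...   | no c≰q  = <-asym c<d (subst₂ _<_ (fixed-above d (≰⇒> d≰q)) (fixed-above c (≰⇒> c≰q)) fd<fc)
        ...   | yes c≤q = <-irrefl refl (<-≤-trans q<fc (subst (_≤ q) (trans (sym (f-inv c)) (fixed-above (f c) q<fc)) c≤q))
          where
            q<fc : q < f c
            q<fc = <-trans (≰⇒> d≰q) (subst (_< f c) (fixed-above d (≰⇒> d≰q)) fd<fc)

    -- a violation a < b < i of LeftClear yields a smaller ascent, at the crossing of f a in b‥i
    left-clear-ascent : ∀ i → Acc _<_ i → AscentBelow f q i → Σ ℕ λ j → AscentBelow f q j × LeftClear f j
    left-clear-ascent i (acc smaller) asc-i with left-clear? i
    ... | inj₁ clear = i , asc-i , clear
    ... | inj₂ (a , b , 1≤a , a<b , b<i , fb<fa , fa<fi) with last-below f (f a) i b<i fb<fa (λ fi<fa → <-asym fi<fa fa<fi)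
    ...   | j , b≤j , j<i , fj<fa , ¬f1+j<fa =
      left-clear-ascent j (smaller j<i)
        (crossing-ascent (≤-trans 1≤a (≤-trans (<⇒≤ a<b) b≤j)) (<-trans j<i (proj₁ (proj₂ asc-i)))
                         (λ a≡1+j → <-irrefl a≡1+j (<-≤-trans a<b (≤-trans b≤j (n≤1+n j)))) fj<fa ¬f1+j<fa)

    -- a violation i+1 < c < d of RightClear yields a larger ascent, at the crossing of f d in i+1‥c,
    -- which stays LeftClear since f is vexillary
    good-ascent-from : ∀ i → Acc _<_ (q ∸ i) → AscentBelow f q i → LeftClear f i → Σ ℕ (GoodAscent f q)
    good-ascent-from i (acc smaller) asc-i left-i with right-clear? i
    ... | inj₁ right-i = i , asc-i , left-i , right-i
    ... | inj₂ (c , d , 1+i<c , c<d , d≤q , f1+i<fd , fd<fc) with last-below f (f d) c 1+i<c f1+i<fd (λ fc<fd → <-asym fc<fd fd<fc)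
    ...   | j , 1+i≤j , j<c , fj<fd , ¬f1+j<fd =
      good-ascent-from j (smaller (∸-monoʳ-< 1+i≤j (<⇒≤ j<q)))
        (crossing-ascent (≤-trans (s≤s z≤n) 1+i≤j) j<q (λ d≡1+j → <-irrefl (sym d≡1+j) (≤-<-trans j<c c<d))
                         fj<fd ¬f1+j<fd)
        left-j
      where
        j<q = <-trans j<c (<-≤-trans c<d d≤q)
        left-j : LeftClear f j
        left-j a b 1≤a a<b b<j (fb<fa , fa<fj) =
          f-vex a b c d 1≤a a<b (<-trans b<j j<c) c<d (fb<fa , <-trans fa<fj fj<fd , fd<fc)

  good-ascent : ∀ {i} → AscentBelow f q i → Σ ℕ (GoodAscent f q)
  good-ascent {i} asc-i with left-clear-ascent i (<-wellFounded i) asc-i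
  ... | j , asc-j , left-j = good-ascent-from j (<-wellFounded (q ∸ j)) asc-j left-j

injective-into-range : ∀ n lo hi (g : ℕ → ℕ) → (∀ x → x < n → lo ≤ g x × g x < hi) →
  (∀ x y → x < n → y < n → g x ≡ g y → x ≡ y) → n ≤ hi ∸ lo
injective-into-range n lo hi g in-range g-injective = injective⇒≤ {f = h} h-injective
  where
    shifted< : ∀ (x : Fin n) → g (toℕ x) ∸ lo < hi ∸ lo
    shifted< x = let (lo≤gx , gx<hi) = in-range (toℕ x) (toℕ<n x) in ∸-monoˡ-< gx<hi lo≤gx
    h : Fin n → Fin (hi ∸ lo)
    h x = fromℕ< (shifted< x)
    h-injective : ∀ {x y} → h x ≡ h y → x ≡ y
    h-injective {x} {y} e = toℕ-injective (g-injective _ _ (toℕ<n x) (toℕ<n y)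
      (∸-cancelʳ-≡ (proj₁ (in-range _ (toℕ<n x))) (proj₁ (in-range _ (toℕ<n y)))
        (trans (sym (toℕ-fromℕ< (shifted< x))) (trans (cong toℕ e) (toℕ-fromℕ< (shifted< y))))))

count-downClosed : ∀ n {P : ℕ → Set} (P? : Decidable P) → (∀ j k → 1 ≤ k → k ≤ j → P j → P k) →
  ∀ j → 1 ≤ j → j ≤ n → (P j → j ≤ sumTo n (𝟙 ∘ P?)) × (j ≤ sumTo n (𝟙 ∘ P?) → P j)
count-downClosed zero    P? down j 1≤j j≤0 = ⊥-elim (<-irrefl refl (≤-trans 1≤j j≤0))
count-downClosed (suc n) P? down j 1≤j j≤1+n with P? (suc n)
... | yes P1+n = (λ _ → subst (j ≤_) (sym all-below) j≤1+n) , (λ _ → down (suc n) j 1≤j j≤1+n P1+n)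
  where
    all-below : sumTo n (𝟙 ∘ P?) + 1 ≡ suc n
    all-below = trans (cong (_+ 1) (trans (sumTo-cong n λ x 1≤x x≤n →
                                             𝟙-yes (P? x) (down (suc n) x 1≤x (m≤n⇒m≤1+n x≤n) P1+n))
                                          (trans (sumTo-const n 1) (*-identityʳ n))))
                      (+-comm n 1)
... | no ¬P1+n with m≤n⇒m<n∨m≡n j≤1+n
...   | inj₁ j<1+n = (λ Pj → subst (j ≤_) (sym (+-identityʳ _)) (proj₁ below Pj))
                   , (λ j≤c → proj₂ below (subst (j ≤_) (+-identityʳ _) j≤c))
  where below = count-downClosed n P? down j 1≤j (≤-pred j<1+n)
...   | inj₂ refl  = (λ P1+n → ⊥-elim (¬P1+n P1+n))
                   , (λ 1+n≤c → ⊥-elim (<-irrefl refl (<-≤-trans (s≤s (sumTo-𝟙≤n n P?))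
                                                                  (subst (suc n ≤_) (+-identityʳ _) 1+n≤c))))

dom-≤p : ∀ p q j → 1 ≤ j → j ≤ p → dom p q j ≡ suc q ∸ j
dom-≤p p q j 1≤j j≤p with 1 ≤? j | j ≤? p | suc q ∸ p ≤? j | j ≤? q
... | yes _ | yes _ | _ | _ = refl
... | no 1≰j | _    | _ | _ = ⊥-elim (1≰j 1≤j)
... | yes _ | no j≰p | _ | _ = ⊥-elim (j≰p j≤p)

dom-mirror : ∀ p q j → p < j → suc q ∸ p ≤ j → j ≤ q → dom p q j ≡ suc q ∸ j
dom-mirror p q j p<j q+1-p≤j j≤q with 1 ≤? j | j ≤? p | suc q ∸ p ≤? j | j ≤? q
... | yes _ | no _   | yes _ | yes _ = refl
... | no 1≰j | _     | _     | _     = ⊥-elim (1≰j (≤-trans (s≤s z≤n) p<j))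
... | yes _ | yes j≤p | _    | _     = ⊥-elim (<-irrefl refl (<-≤-trans p<j j≤p))
... | yes _ | no _   | no ≰j | _     = ⊥-elim (≰j q+1-p≤j)
... | yes _ | no _   | yes _ | no j≰q = ⊥-elim (j≰q j≤q)

dom-fixed : ∀ p q j → p < j → j < suc q ∸ p ⊎ q < j → dom p q j ≡ j
dom-fixed p q j p<j outside with 1 ≤? j | j ≤? p | suc q ∸ p ≤? j | j ≤? q
... | _     | yes j≤p | _      | _      = ⊥-elim (<-irrefl refl (<-≤-trans p<j j≤p))
... | yes _ | no _    | yes q+1-p≤j | yes j≤q with outside
...   | inj₁ j<q+1-p = ⊥-elim (<-irrefl refl (<-≤-trans j<q+1-p q+1-p≤j))
...   | inj₂ q<j     = ⊥-elim (<-irrefl refl (<-≤-trans q<j j≤q))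
dom-fixed p q j p<j outside | yes _ | no _ | yes _ | no _ = refl
dom-fixed p q j p<j outside | yes _ | no _ | no _  | _    = refl
dom-fixed p q j p<j outside | no _  | no _ | _     | _    = refl

module _ (f : ℕ → ℕ) (q : ℕ) (f0≡0 : f 0 ≡ 0) (f-inv : Involutive f) (fixed-above : ∀ j → q < j → f j ≡ j)
         (no-ascent : ∀ j → ¬ AscentBelow f q j) where
  private
    f-injective : ∀ {x y} → f x ≡ f y → x ≡ y
    f-injective {x} {y} e = trans (sym (f-inv x)) (trans (cong f e) (f-inv y))

    f-positive : ∀ {x} → 1 ≤ x → 1 ≤ f x
    f-positive {x} 1≤x with f x ≟ 0
    ... | no fx≢0  = ≤∧≢⇒< z≤n (fx≢0 ∘ sym)
    ... | yes fx≡0 = ⊥-elim (<-irrefl (sym (f-injective (trans fx≡0 (sym f0≡0)))) 1≤x)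

    f-≤q : ∀ {x} → x ≤ q → f x ≤ q
    f-≤q {x} x≤q with f x ≤? q
    ... | yes fx≤q = fx≤q
    ... | no fx≰q  = ⊥-elim (fx≰q (subst (_≤ q) (trans (sym (f-inv x)) (fixed-above (f x) (≰⇒> fx≰q))) x≤q))

    descent-or-fixed : ∀ i → 1 ≤ i → i < q → f (suc i) < f i ⊎ (f i ≡ i × f (suc i) ≡ suc i)
    descent-or-fixed i 1≤i i<q with (f i ≟ i) ×-dec (f (suc i) ≟ suc i)
    ... | yes fixed-pair = inj₂ fixed-pair
    ... | no ¬fixed-pair with f i <? f (suc i)
    ...   | yes asc = ⊥-elim (no-ascent i (1≤i , i<q , asc , ¬fixed-pair))
    ...   | no ¬asc = inj₁ (≤∧≢⇒< (≮⇒≥ ¬asc) (λ e → <-irrefl (sym (f-injective e)) (n<1+n i)))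

    FixedOn : ℕ → ℕ → Set
    FixedOn i j = ∀ k → i ≤ k → k ≤ j → f k ≡ k

    descends-or-fixed : ∀ i j → 1 ≤ i → i < j → j ≤ q → f j < f i ⊎ FixedOn i j
    descends-or-fixed i (suc j) 1≤i i<1+j 1+j≤q with m≤n⇒m<n∨m≡n (≤-pred i<1+j)
    ... | inj₂ refl with descent-or-fixed i 1≤i 1+j≤q
    ...   | inj₁ desc          = inj₁ desc
    ...   | inj₂ (fi≡i , f1+i≡1+i) = inj₂ λ k i≤k k≤1+i → case m≤n⇒m<n∨m≡n i≤k of λ where
             (inj₂ refl) → fi≡i
             (inj₁ i<k)  → subst (λ k → f k ≡ k) (≤-antisym i<k k≤1+i) f1+i≡1+i
    descends-or-fixed i (suc j) 1≤i i<1+j 1+j≤q | inj₁ i<j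
      with descends-or-fixed i j 1≤i i<j (≤-trans (n≤1+n j) 1+j≤q)
         | descent-or-fixed j (≤-trans 1≤i (<⇒≤ i<j)) 1+j≤q
    ... | inj₁ fj<fi | inj₁ f1+j<fj = inj₁ (<-trans f1+j<fj fj<fi)
    ... | inj₁ fj<fi | inj₂ (fj≡j , f1+j≡1+j) =
      inj₁ (subst (_< f i) (sym f1+j≡1+j) (≤∧≢⇒< (subst (_< f i) fj≡j fj<fi)
             (λ 1+j≡fi → <-irrefl (sym (f-injective (trans f1+j≡1+j 1+j≡fi))) (<-trans i<j (n<1+n j)))))
    ... | inj₂ fixed | inj₁ f1+j<fj =
      inj₁ (subst (f (suc j) <_) (sym (fixed i ≤-refl (<⇒≤ i<j)))
              (below-block (subst (f (suc j) <_) (fixed j (<⇒≤ i<j) ≤-refl) f1+j<fj)))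
      where
        below-block : f (suc j) < j → f (suc j) < i
        below-block f1+j<j with f (suc j) <? i
        ... | yes f1+j<i = f1+j<i
        ... | no f1+j≮i  = ⊥-elim (<-irrefl (sym (trans (sym (f-inv (suc j)))
                                     (fixed (f (suc j)) (≮⇒≥ f1+j≮i) (<⇒≤ f1+j<j))))
                                   (<-trans f1+j<j (n<1+n j)))
    ... | inj₂ fixed | inj₂ (_ , f1+j≡1+j) = inj₂ λ k i≤k k≤1+j → case m≤n⇒m<n∨m≡n k≤1+j of λ where
             (inj₁ k<1+j) → fixed k i≤k (≤-pred k<1+j)
             (inj₂ refl)  → f1+j≡1+j

    moved-below : ∀ {j k} → 1 ≤ k → k < j → j ≤ q → f j ≢ j → f j < f k
    moved-below {j} {k} 1≤k k<j j≤q fj≢j with descends-or-fixed k j 1≤k k<j j≤q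
    ... | inj₁ fj<fk = fj<fk
    ... | inj₂ fixed = ⊥-elim (fj≢j (fixed j (<⇒≤ k<j) ≤-refl))

    moved-above : ∀ {j k} → 1 ≤ j → j < k → k ≤ q → f j ≢ j → f k < f j
    moved-above {j} {k} 1≤j j<k k≤q fj≢j with descends-or-fixed j k 1≤j j<k k≤q
    ... | inj₁ fk<fj = fk<fj
    ... | inj₂ fixed = ⊥-elim (fj≢j (fixed j ≤-refl (<⇒≤ j<k)))

    -- The j − 1 values left of a moved point j lie in (f j, q] and the q − j values right of it
    -- in [1, f j), so injectivity forces f j + j = q + 1.
    moved-mirror : ∀ j → 1 ≤ j → j ≤ q → f j ≢ j → f j ≡ suc q ∸ j
    moved-mirror (suc j′) 1≤j j≤q fj≢j = sym (trans (cong (_∸ j′) (sym v+j′≡q)) (m+n∸n≡m v j′))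
      where
        j = suc j′
        v = f j
        left-count : j′ ≤ q ∸ v
        left-count = injective-into-range j′ (suc v) (suc q) (λ x → f (suc x))
          (λ x x<j′ → moved-below (s≤s z≤n) (s≤s x<j′) j≤q fj≢j ,
                      s≤s (f-≤q (≤-trans (s≤s (<⇒≤ x<j′)) j≤q)))
          (λ x y _ _ e → suc-injective (f-injective e))
        right-count : q ∸ j ≤ v ∸ 1
        right-count = injective-into-range (q ∸ j) 1 v (λ x → f (suc (x + j)))
          (λ x x<q-j → f-positive (s≤s z≤n) ,
             moved-above 1≤j (s≤s (m≤n+m j x)) (subst (suc (x + j) ≤_) (m∸n+n≡m j≤q) (+-monoˡ-≤ j x<q-j)) fj≢j)
          (λ x y _ _ e → +-cancelʳ-≡ j x y (suc-injective (f-injective e)))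
        v+j′≡q : v + j′ ≡ q
        v+j′≡q = ≤-antisym
          (subst (_≤ q) (+-comm j′ v) (subst (j′ + v ≤_) (m∸n+n≡m (f-≤q j≤q)) (+-monoˡ-≤ v left-count)))
          (≤-trans (m≤n+m∸n q j) (≤-trans (+-monoʳ-≤ j right-count) (≤-reflexive (j+[v∸1]≡v+j′ (f-positive 1≤j)))))
          where
            j+[v∸1]≡v+j′ : 1 ≤ v → j + (v ∸ 1) ≡ v + j′
            j+[v∸1]≡v+j′ 1≤v with v
            ... | suc v′ = cong suc (+-comm j′ v′)

    Opener : ℕ → Set
    Opener j = j < f j

    opener-≤q : ∀ {j} → Opener j → j ≤ q
    opener-≤q {j} j<fj with j ≤? q
    ... | yes j≤q = j≤q
    ... | no j≰q  = ⊥-elim (<-irrefl (sym (fixed-above j (≰⇒> j≰q))) j<fj)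

    opener-moved : ∀ {j} → Opener j → f j ≢ j
    opener-moved j<fj fj≡j = <-irrefl (sym fj≡j) j<fj

    opener-positive : ∀ {j} → Opener j → 1 ≤ j
    opener-positive {zero}  0<f0 = ⊥-elim (<-irrefl (sym f0≡0) 0<f0)
    opener-positive {suc j} _    = s≤s z≤n

    opener-mirror : ∀ {j} → Opener j → f j ≡ suc q ∸ j
    opener-mirror op = moved-mirror _ (opener-positive op) (opener-≤q op) (opener-moved op)

    opener-downClosed : ∀ j k → 1 ≤ k → k ≤ j → Opener j → Opener k
    opener-downClosed j k 1≤k k≤j op with m≤n⇒m<n∨m≡n k≤j
    ... | inj₂ refl = op
    ... | inj₁ k<j with f k ≟ k
    ...   | yes fk≡k = ⊥-elim (<-asym op (<-trans (subst (f j <_) fk≡k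
                                    (moved-below 1≤k k<j (opener-≤q op) (opener-moved op))) k<j))
    ...   | no fk≢k  = subst (k <_) (sym (moved-mirror k 1≤k (≤-trans (<⇒≤ k<j) (opener-≤q op)) fk≢k))
                          (<-trans k<j (<-≤-trans (subst (j <_) (opener-mirror op) op) (∸-monoʳ-≤ (suc q) k≤j)))

  module _ (B : ℕ) (q≤B : q ≤ B) where
    private
      p : ℕ
      p = sumTo B (λ j → 𝟙 (j <? f j))

      opener⇔≤p : ∀ j → 1 ≤ j → (Opener j → j ≤ p) × (j ≤ p → Opener j)
      opener⇔≤p j 1≤j with j ≤? B
      ... | yes j≤B = count-downClosed B (λ x → x <? f x) opener-downClosed j 1≤j j≤B
      ... | no j≰B  = (λ op → ⊥-elim (j≰B (≤-trans (opener-≤q op) q≤B)))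
                    , (λ j≤p → ⊥-elim (j≰B (≤-trans j≤p (sumTo-𝟙≤n B (λ x → x <? f x)))))

      p≤q : p ≤ q
      p≤q with p ≤? q
      ... | yes p≤q = p≤q
      ... | no p≰q  = ⊥-elim (p≰q (opener-≤q (proj₂ (opener⇔≤p p (≤-<-trans z≤n (≰⇒> p≰q))) ≤-refl)))

      beyond-p : ∀ j → p < j → j ≤ q → f j ≡ dom p q j
      beyond-p j p<j j≤q with f j ≟ j
      ... | no fj≢j = trans fj≡mirror (sym (dom-mirror p q j p<j q+1-p≤j j≤q))
        where
          1≤j = ≤-trans (s≤s z≤n) p<j
          fj≡mirror : f j ≡ suc q ∸ j
          fj≡mirror = moved-mirror j 1≤j j≤q fj≢j
          fj-opener : Opener (f j)
          fj-opener = subst (f j <_) (sym (f-inv j))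
                        (≤∧≢⇒< (≮⇒≥ (λ op → <-irrefl refl (<-≤-trans p<j (proj₁ (opener⇔≤p j 1≤j) op)))) fj≢j)
          q+1-p≤j : suc q ∸ p ≤ j
          q+1-p≤j = subst (suc q ∸ p ≤_) (trans (cong (suc q ∸_) fj≡mirror) (m∸[m∸n]≡n (m≤n⇒m≤1+n j≤q)))
                      (∸-monoʳ-≤ (suc q) (proj₁ (opener⇔≤p (f j) (f-positive 1≤j)) fj-opener))
      ... | yes fj≡j = trans fj≡j (sym (dom-fixed p q j p<j (inj₁ (≰⇒> not-mirrored))))
        where
          not-mirrored : ¬ (suc q ∸ p ≤ j)
          not-mirrored q+1-p≤j = opener-moved k-opener (trans fk≡j (sym (f-injective (trans fk≡j (sym fj≡j)))))
            where
              k = suc q ∸ j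
              k-opener : Opener k
              k-opener = proj₂ (opener⇔≤p k (subst (1 ≤_) (sym (+-∸-assoc 1 j≤q)) (s≤s z≤n)))
                           (subst (k ≤_) (m∸[m∸n]≡n (m≤n⇒m≤1+n p≤q)) (∸-monoʳ-≤ (suc q) q+1-p≤j))
              fk≡j : f k ≡ j
              fk≡j = trans (opener-mirror k-opener) (m∸[m∸n]≡n (m≤n⇒m≤1+n j≤q))

    no-ascent⇒dom : ∀ j → f j ≡ dom (sumTo B (λ j → 𝟙 (j <? f j))) q j
    no-ascent⇒dom zero = f0≡0
    no-ascent⇒dom j@(suc _) = by-cases (j ≤? p) (j ≤? q)
      where
        -- a separate function, as `with j ≤? p` would also abstract inside dom p q j
        by-cases : Dec (j ≤ p) → Dec (j ≤ q) → f j ≡ dom p q j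
        by-cases (yes j≤p) _         = trans (opener-mirror op) (sym (dom-≤p p q j (s≤s z≤n) j≤p))
          where op = proj₂ (opener⇔≤p j (s≤s z≤n)) j≤p
        by-cases (no j≰p)  (yes j≤q) = beyond-p j (≰⇒> j≰p) j≤q
        by-cases (no j≰p)  (no j≰q)  =
          trans (fixed-above j (≰⇒> j≰q)) (sym (dom-fixed p q j (≰⇒> j≰p) (inj₂ (≰⇒> j≰q))))

ℓ≤bound² : ∀ π → ℓ π ≤ bound π * bound π
ℓ≤bound² π = subst (_≤ bound π * bound π) (sym (ℓ≡inversions π (bound π) ≤-refl)) (inversions-≤ (bound π) (fun π))

-- Along an edge i is an ascent: if v (i + 1) < v i then v = s_i u s_i would be longer than u.
edge-ascent : ∀ {v i u} → Edge v i u → fun v i < fun v (suc i)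
edge-ascent {v} {i} {u} ((_ , v-inv) , (_ , u-inv) , 1≤i , u≡svs , ℓv<ℓu) with fun v i ≟ suc i
... | yes vi≡1+i = ⊥-elim (<-irrefl ℓv≡ℓu ℓv<ℓu)
  where
    N = bound v ⊔ bound u
    ℓv≡ℓu : ℓ v ≡ ℓ u
    ℓv≡ℓu = trans (ℓ≡inversions v N (m≤m⊔n _ _))
              (trans (inversions-cong N (λ j → sym (trans (u≡svs j) (s-conj-trivial (fun v) i v-inv vi≡1+i j))))
                     (sym (ℓ≡inversions u N (m≤n⊔m _ _))))
... | no vi≢1+i with fun v i <? fun v (suc i)
...   | yes asc = asc
...   | no ¬asc = ⊥-elim (<-asym ℓv<ℓu (subst₂ _<_ (sym (ℓ≡inversions u N u≤N)) (sym (ℓ≡inversions v N v≤N))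
          (inversions-conj-ascent N i 1≤i 1+i≤N u-inv v≡sus (u-asc , u-nontrivial))))
  where
    N = (bound v ⊔ bound u) ⊔ suc i
    v≤N = ≤-trans (m≤m⊔n (bound v) (bound u)) (m≤m⊔n _ (suc i))
    u≤N = ≤-trans (m≤n⊔m (bound v) (bound u)) (m≤m⊔n _ (suc i))
    1+i≤N = m≤n⊔m (bound v ⊔ bound u) (suc i)
    v≡sus : ∀ j → fun v j ≡ s i (fun u (s i j))
    v≡sus j = sym (trans (cong (s i) (trans (u≡svs (s i j)) (cong (λ t → s i (fun v t)) (s-involutive i j))))
                         (s-involutive i (fun v j)))
    ui≡sv1+i : fun u i ≡ s i (fun v (suc i))
    ui≡sv1+i = trans (u≡svs i) (cong (λ t → s i (fun v t)) (s-at-i i))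
    u1+i≡svi : fun u (suc i) ≡ s i (fun v i)
    u1+i≡svi = trans (u≡svs (suc i)) (cong (λ t → s i (fun v t)) (s-at-suc i))
    v-desc : fun v (suc i) < fun v i
    v-desc = ≤∧≢⇒< (≮⇒≥ ¬asc) (λ e → <-irrefl (sym (injective v _ _ e)) (n<1+n i))
    u-asc : fun u i < fun u (suc i)
    u-asc = subst₂ _<_ (sym ui≡sv1+i) (sym u1+i≡svi) (s-mono-< i v-desc (vi≢1+i ∘ proj₂))
    u-nontrivial : ¬ (fun u i ≡ i × fun u (suc i) ≡ suc i)
    u-nontrivial (ui≡i , u1+i≡1+i) = <-asym (subst₂ _<_ v1+i≡1+i vi≡i v-desc) (n<1+n i)
      where
        vi≡i = trans (sym (s-involutive i (fun v i))) (trans (cong (s i) (trans (sym u1+i≡svi) u1+i≡1+i)) (s-at-suc i))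
        v1+i≡1+i = trans (sym (s-involutive i (fun v (suc i)))) (trans (cong (s i) (trans (sym ui≡sv1+i) ui≡i)) (s-at-i i))

OpenersExactly : ℕ → Perm → Set
OpenersExactly p v = ∀ j → 1 ≤ j → (j < fun v j → j ≤ p) × (j ≤ p → j < fun v j)

s-≤-iff : ∀ {i p} j → i ≢ p → (s i j ≤ p → j ≤ p) × (j ≤ p → s i j ≤ p)
s-≤-iff {i} {p} j i≢p with s-view i j
... | at-i refl e   = (λ sj≤p → ≤-trans (n≤1+n j) (subst (_≤ p) e sj≤p)) ,
                      (λ j≤p → subst (_≤ p) (sym e) (≤∧≢⇒< j≤p i≢p))
... | at-suc refl e = (λ sj≤p → ≤∧≢⇒< (subst (_≤ p) e sj≤p) i≢p) , (λ j≤p → subst (_≤ p) (sym e) (≤-trans (n≤1+n i) j≤p))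
... | away _ _ e    = subst (_≤ p) e , subst (_≤ p) (sym e)

openersExactly-edge : ∀ {p v i u} → Edge v i u → i ≢ p → OpenersExactly p v → OpenersExactly p u
openersExactly-edge {p} {v} {i} {u} ((_ , v-inv) , _ , 1≤i , u≡svs , _) i≢p openers j 1≤j with fun v i ≟ suc i
... | yes vi≡1+i = proj₁ (openers j 1≤j) ∘ subst (j <_) (sym (u≡v j)) , subst (j <_) (u≡v j) ∘ ≤p⇒opener
  where
    u≡v : ∀ j → fun v j ≡ fun u j
    u≡v j = sym (trans (u≡svs j) (s-conj-trivial (fun v) i v-inv vi≡1+i j))
    ≤p⇒opener = proj₂ (openers j 1≤j)
... | no vi≢1+i =
  (λ j<uj → proj₁ (s-≤-iff j i≢p) (proj₁ sj-opener⇔ (from-u j<uj))) ,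
  (λ j≤p → to-u (proj₂ sj-opener⇔ (proj₂ (s-≤-iff j i≢p) j≤p)))
  where
    sj-opener⇔ = openers (s i j) (s-positive i j 1≤i 1≤j)
    transport = s-opener-iff (fun v) i v-inv vi≢1+i (s i j)
    from-u : j < fun u j → s i j < fun v (s i j)
    from-u j<uj = proj₂ transport (subst₂ _<_ (sym (s-involutive i j)) (u≡svs j) j<uj)
    to-u : s i j < fun v (s i j) → j < fun u j
    to-u lt = subst₂ _<_ (s-involutive i j) (sym (u≡svs j)) (proj₁ transport lt)

-- p is a descent of any v whose openers are exactly 1‥p, so no edge out of v is labelled p.
openersExactly-path : ∀ {p v t is} → OpenersExactly p v → Path v t is → p ∉ is
openersExactly-path {p} openers (step {v = v} {u = u} {i = i} edge rest) p∈ with i ≟ p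
... | yes refl = <-irrefl refl (<-≤-trans p<vp (≤-pred (<-≤-trans (edge-ascent {v} {i} {u} edge) v1+p≤1+p)))
  where
    p<vp : p < fun v p
    p<vp = proj₂ (openers p (proj₁ (proj₂ (proj₂ edge)))) ≤-refl
    v1+p≤1+p : fun v (suc p) ≤ suc p
    v1+p≤1+p = ≮⇒≥ (λ 1+p<v1+p → <-irrefl refl (proj₁ (openers (suc p) (s≤s z≤n)) 1+p<v1+p))
... | no i≢p with p∈
...   | here p≡i   = i≢p (sym p≡i)
...   | there p∈is = openersExactly-path (openersExactly-edge {p} {v} {i} {u} edge i≢p openers) rest p∈is

sumTo-𝟙[≤m]≡m : ∀ n m → m ≤ n → sumTo n (λ x → 𝟙 (x ≤? m)) ≡ m
sumTo-𝟙[≤m]≡m zero    .zero z≤n = refl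
sumTo-𝟙[≤m]≡m (suc n) m m≤1+n with m≤n⇒m<n∨m≡n m≤1+n
... | inj₁ m<1+n = trans (cong₂ _+_ (sumTo-𝟙[≤m]≡m n m (≤-pred m<1+n)) (𝟙-no (suc n ≤? m) (<⇒≱ m<1+n)))
                         (+-identityʳ m)
... | inj₂ refl  = trans (cong₂ _+_ (trans (sumTo-cong n λ x _ x≤n → 𝟙-yes (x ≤? suc n) (m≤n⇒m≤1+n x≤n))
                                           (trans (sumTo-const n 1) (*-identityʳ n)))
                                    (𝟙-yes (suc n ≤? suc n) ≤-refl))
                         (+-comm n 1)

-- If 1‥pOf z are openers, no other point can be one, since pOf z counts all openers.
openersExactly-pOf : ∀ z → (∀ i → 1 ≤ i → i ≤ pOf z → i < fun z i) → OpenersExactly (pOf z) z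
openersExactly-pOf z first-openers j 1≤j = opener⇒≤p , first-openers j 1≤j
  where
    p = pOf z
    B = bound z
    opener⇒≤p : j < fun z j → j ≤ p
    opener⇒≤p j<zj with j ≤? p
    ... | yes j≤p = j≤p
    ... | no j≰p with j ≤? B
    ...   | no j≰B  = ⊥-elim (<-irrefl (sym (fix-above z j (≰⇒> j≰B))) j<zj)
    ...   | yes j≤B = ⊥-elim (<-irrefl (trans (sumTo-𝟙[≤m]≡m B p (pOf-≤-bound z)) (pOf≡sumTo z)) more-openers)
      where
        more-openers : sumTo B (λ x → 𝟙 (x ≤? p)) < sumTo B (λ x → 𝟙 (x <? fun z x))
        more-openers = sumTo-mono-< B (λ x 1≤x _ → 𝟙-mono (x ≤? p) (x <? fun z x) (first-openers x 1≤x))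
                         j 1≤j j≤B (𝟙-< (j ≤? p) (j <? fun z j) j≰p j<zj)

DomPath : Perm → ℕ → ℕ → Set
DomPath z p q = Σ (List ℕ) λ is → Path z (dom p q) is × All (λ i → 1 ≤ i × i ≤ q ∸ 1) is

-- Terminates since each edge increases ℓ, which stays below bound², the bound being unchanged.
dom-path : ∀ z → VexInv z → Acc _<_ (bound z * bound z ∸ ℓ z) → DomPath z (pOf z) (qOf z)
dom-path z (z-vex , z-inv) (acc shorter) with anyUpTo? (ascentBelow? (fun z) (qOf z)) (qOf z)
... | no none = [] , done (λ j → subst (λ p → fun z j ≡ dom p (qOf z) j) (sym (pOf≡sumTo z))
                   (no-ascent⇒dom (fun z) (qOf z) (fix-zero z) z-inv (fixed-above-qOf z) no-ascent (bound z) (qOf-≤-bound z) j)) , []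
  where
    no-ascent : ∀ j → ¬ AscentBelow (fun z) (qOf z) j
    no-ascent j asc = none (j , proj₁ (proj₂ asc) , asc)
... | yes (_ , _ , asc) with good-ascent z-inv (fixed-above-qOf z) z-vex asc
... | i , (1≤i , i<q , nontrivial) , left , right =
  extend (subst₂ (DomPath w) (pOf-conjugate z i 1≤i 1+i≤b z-inv) (qOf-conjugate z i 1≤i 1+i≤b z-inv i<q (proj₁ nontrivial))
                 (dom-path w (w-vex , w-inv) (shorter (∸-monoʳ-< ℓz<ℓw (ℓ≤bound² w)))))
  where
    1+i≤b = ≤-trans i<q (qOf-≤-bound z)
    w = conjugate z i 1≤i 1+i≤b
    w-vex : IsVexillary w
    w-vex = conjugate-vexillary 1≤i (fix-zero z) z-inv z-vex nontrivial left right
    w-inv : IsInvolution w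
    w-inv = conjugate-involution z i 1≤i 1+i≤b z-inv
    ℓz<ℓw : ℓ z < ℓ w
    ℓz<ℓw = ℓ-conjugate-ascent z i 1≤i 1+i≤b z-inv nontrivial
    edge : Edge z i w
    edge = (z-vex , z-inv) , (w-vex , w-inv) , 1≤i , (λ _ → refl) , ℓz<ℓw
    i≤q∸1 : ∀ {q} → i < q → i ≤ q ∸ 1
    i≤q∸1 {suc q} i<1+q = ≤-pred i<1+q
    extend : DomPath w (pOf z) (qOf z) → DomPath z (pOf z) (qOf z)
    extend (is , path , labels) = i ∷ is , step edge path , (1≤i , i≤q∸1 i<q) ∷ labels

theorem2p2 : (z : Perm) → VexInv z →
    (Σ (List ℕ) λ is → Path z (dom (pOf z) (qOf z)) is × All (λ i → 1 ≤ i × i ≤ qOf z ∸ 1) is)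
    × ((∀ i → 1 ≤ i → i ≤ pOf z → i < fun z i) →
       ∀ is → Path z (dom (pOf z) (qOf z)) is → All (λ i → 1 ≤ i × i ≤ qOf z ∸ 1) is →
       pOf z ∉ is)
theorem2p2 z vex-inv =
  dom-path z vex-inv (<-wellFounded _) ,
  λ first-openers _ path _ → openersExactly-path (openersExactly-pOf z first-openers) path
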